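{- For any $m$-stable affine permutation $\omega$, the function $\mathrm{PS}_\omega$ is an $m/n$-parking function. Thus one gets a map $\mathrm{PS}:\widetilde{S}_n^m\to\mathrm{PF}_{m/n}$.
   Context: Let $m,n$ be coprime positive integers. An affine permutation is a bijection $\omega:\mathbb{Z}\to\mathbb{Z}$ with $\omega(x+n)=\omega(x)+n$ for all $x$ and $\sum_{i=1}^n\omega(i)=\frac{n(n+1)}{2}$; it is $m$-stable if $\omega(x+m)>\omega(x)$ for all $x$, and $\widetilde{S}_n^m$ denotes the set of $m$-stable affine permutations. A function $f:\{1,\dots,n\}\to\mathbb{Z}_{\ge0}$ is an $m/n$-parking function if for every $i\in\{0,\dots,n-1\}$, $\sharp\{k: f(k)\le \frac{im}{n}\}\ge i+1$ (equivalently, the Young diagram with rows $f(1),\dots,f(n)$ sorted decreasingly fits under the diagonal of an $n\times m$ rectangle); $\mathrm{PF}_{m/n}$ is the set of these. For $\omega\in\widetilde{S}_n^m$ and $\alpha\in\{1,\dots,n\}$ define $\mathrm{PS}_\omega(\alpha):=\sharp\{i:\ \omega(i)>\alpha,\ \omega^{ -1}(\alpha)-m<i<\omega^{ -1}(\alpha)\}$, i.e. the number of inversions $(i,j)$ of $\omega$ ($i<j$, $\omega(i)>\omega(j)$, counted up to simultaneous shifts by multiples of $n$) of height $j-i<m$ with $\omega(j)\equiv\alpha \bmod n$. -}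

module Defs where

open import Data.Nat as ℕ using (ℕ; zero; suc; _≤_; _≤?_; _/_)
open import Data.Integer as ℤ using (ℤ; +_; _-_; _<_; _<?_)
open import Data.Fin using (Fin; toℕ)
open import Data.List using (List; length; filter; allFin; map; upTo; sum)
open import Data.Product using (proj₁; _×_)
open import Function.Definitions using (Bijective)
open import Relation.Binary.PropositionalEquality using (_≡_; refl)

sumℤ : ℕ → (ℤ → ℤ) → ℤ
sumℤ zero    g = + 0
sumℤ (suc k) g = sumℤ k g ℤ.+ g (+ suc k)

record AffinePerm (n : ℕ) : Set where
  field
    ω        : ℤ → ℤ
    bij      : Bijective _≡_ _≡_ ω
    periodic : ∀ x → ω (x ℤ.+ + n) ≡ ω x ℤ.+ + n
    normal   : sumℤ n ω ≡ + ((n ℕ.* suc n) / 2)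
open AffinePerm public

inv : ∀ {n} → AffinePerm n → ℤ → ℤ
inv w y = proj₁ (Data.Product.proj₂ (bij w) y)

Stable : ℕ → ∀ {n} → AffinePerm n → Set
Stable m w = ∀ x → ω w x < ω w (x ℤ.+ + m)

-- PS_ω(α) = #{ i : ω(i) > α, ω⁻¹(α) - m < i < ω⁻¹(α) }.
-- Such i are exactly ω⁻¹(α) - k for k ∈ {1, …, m-1}.
PS : (m : ℕ) → ∀ {n} → AffinePerm n → ℤ → ℕ
PS m w α =
  length (filter (λ k → α <? ω w (inv w α - + k))
                 (map suc (upTo (m ℕ.∸ 1))))

-- m/n-parking function f : {1,…,n} → ℕ (indexed by Fin n, k ↦ k+1):
-- for every i ∈ {0,…,n-1}, #{k : f(k) ≤ i m / n} ≥ i+1,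
-- where f(k) ≤ im/n is written (over ℕ) as n·f(k) ≤ i·m.
IsParking : (m n : ℕ) → (Fin n → ℕ) → Set
IsParking m n f =
  ∀ (i : Fin n) →
    suc (toℕ i) ≤ length (filter (λ k → n ℕ.* f k ≤? toℕ i ℕ.* m) (allFin n))

-- Write PS_ω(α) = I(ω⁻¹ α), where I(y) counts the inversions (y - k, y) of ω of height k < m.
-- I is n-periodic and α ↦ ω⁻¹ α mod n permutes the residues, so PS_ω takes the same values,
-- with multiplicity, as I on 0, …, n - 1.  Within a block of m consecutive positions,
-- m-stability bounds I(a + s) by the number of t < m with ω(a + t) > ω(a + s), and among any
-- m integers at least d (for d ≤ m) have fewer than d larger ones.  Cutting mn consecutive
-- positions into n blocks gives m · #{r < n : I(r) < d} ≥ n · d, which for d = ⌊im/n⌋ + 1 is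
-- the parking condition for i.

module Submission where

open import Function using (_∘_)
open import Data.Nat
open import Data.Nat.Properties
open import Data.Nat.DivMod using (_/_; m*n/n≡m; /-monoˡ-≤; m/n*n≤m; m<n*o⇒m/o<n; m<n⇒m%n≡m)
open import Data.Nat.Coprimality using (Coprime)
open import Data.Integer as ℤ using (ℤ; +_; -[1+_])
import Data.Integer.Properties as ℤP
open import Data.Integer.DivMod using (_/ℕ_; n%ℕd<d; a≡a%ℕn+[a/ℕn]*n)
open import Data.Integer.Tactic.RingSolver using (solve-∀)
open import Data.Fin using (Fin; toℕ; fromℕ<)
open import Data.Fin.Properties using (toℕ-fromℕ<; toℕ-injective; toℕ<n)
open import Data.Fin.Permutation using (Permutation; permutation; _⟨$⟩ʳ_)
open import Data.List using (length; filter; map; applyUpTo; upTo; tabulate; allFin)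
open import Data.List.Properties using (map-upTo)
open import Data.Product using (∃-syntax; _×_; _,_; proj₁; proj₂)
open import Data.Sum using (_⊎_; inj₁; inj₂)
open import Relation.Nullary using (Dec; yes; no; ¬_; contradiction)
open import Relation.Unary using (Pred; Decidable)
open import Relation.Binary.PropositionalEquality
import Algebra.Properties.CommutativeMonoid.Sum as MonoidSum
open MonoidSum +-0-commutativeMonoid using (sum; sum-cong-≗; sum-permute)
open import Defs

∑ : ℕ → (ℕ → ℕ) → ℕ
∑ zero    F = 0
∑ (suc N) F = F 0 + ∑ N (F ∘ suc)

syntax ∑ N (λ k → F) = ∑[ k < N ] F

∑-cong : ∀ N {F G : ℕ → ℕ} → (∀ k → k < N → F k ≡ G k) → ∑ N F ≡ ∑ N G
∑-cong zero    F≡G = refl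
∑-cong (suc N) F≡G = cong₂ _+_ (F≡G 0 z<s) (∑-cong N (λ k k<N → F≡G (suc k) (s<s k<N)))

∑-mono-≤ : ∀ N {F G : ℕ → ℕ} → (∀ k → k < N → F k ≤ G k) → ∑ N F ≤ ∑ N G
∑-mono-≤ zero    F≤G = z≤n
∑-mono-≤ (suc N) F≤G = +-mono-≤ (F≤G 0 z<s) (∑-mono-≤ N (λ k k<N → F≤G (suc k) (s<s k<N)))

∑-const : ∀ N c → ∑[ _ < N ] c ≡ N * c
∑-const zero    c = refl
∑-const (suc N) c = cong (_+_ c) (∑-const N c)

∑-+ : ∀ M N F → ∑ (M + N) F ≡ ∑ M F + ∑[ k < N ] F (M + k)
∑-+ zero    N F = refl
∑-+ (suc M) N F = trans (cong (_+_ (F 0)) (∑-+ M N (F ∘ suc))) (sym (+-assoc (F 0) _ _))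

∑-suc : ∀ N F → ∑ (suc N) F ≡ ∑ N F + F N
∑-suc N F = begin
  ∑ (suc N) F             ≡⟨ cong (λ M → ∑ M F) (+-comm 1 N) ⟩
  ∑ (N + 1) F             ≡⟨ ∑-+ N 1 F ⟩
  ∑ N F + (F (N + 0) + 0) ≡⟨ cong (_+_ (∑ N F)) (trans (+-identityʳ _) (cong F (+-identityʳ N))) ⟩
  ∑ N F + F N             ∎
  where open ≡-Reasoning

∑-* : ∀ M N F → ∑ (M * N) F ≡ ∑[ j < M ] ∑[ k < N ] F (j * N + k)
∑-* zero    N F = refl
∑-* (suc M) N F = begin
  ∑ (N + M * N) F
    ≡⟨ ∑-+ N (M * N) F ⟩
  ∑ N F + ∑[ k < M * N ] F (N + k)
    ≡⟨ cong (_+_ (∑ N F)) (∑-* M N (λ k → F (N + k))) ⟩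
  ∑ N F + ∑[ j < M ] ∑[ k < N ] F (N + (j * N + k))
    ≡⟨ cong (_+_ (∑ N F)) (∑-cong M λ j _ → ∑-cong N λ k _ →
         cong F (sym (+-assoc N (j * N) k))) ⟩
  ∑ N F + ∑[ j < M ] ∑[ k < N ] F (N + j * N + k)
    ∎
  where open ≡-Reasoning

∑-mono-reflect : ∀ N {F G : ℕ → ℕ} →
  (∀ i j → suc (i + j) ≡ N → F i ≤ G j) → ∑ N F ≤ ∑ N G
∑-mono-reflect zero    F≤G = z≤n
∑-mono-reflect (suc N) {F} {G} F≤G = begin
  F 0 + ∑ N (F ∘ suc) ≤⟨ +-mono-≤ (F≤G 0 N refl)
                                  (∑-mono-reflect N λ i j eq → F≤G (suc i) j (cong suc eq)) ⟩
  G N + ∑ N G         ≡⟨ +-comm (G N) (∑ N G) ⟩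
  ∑ N G + G N         ≡⟨ ∑-suc N G ⟨
  ∑ (suc N) G         ∎
  where open ≤-Reasoning

n*x≤c⇒x≤c/n : ∀ n .{{_ : NonZero n}} {x c} → n * x ≤ c → x ≤ c / n
n*x≤c⇒x≤c/n n {x} {c} nx≤c =
  subst (_≤ c / n) (m*n/n≡m x n) (/-monoˡ-≤ n (subst (_≤ c) (*-comm n x) nx≤c))

x≤c/n⇒n*x≤c : ∀ n .{{_ : NonZero n}} {x c} → x ≤ c / n → n * x ≤ c
x≤c/n⇒n*x≤c n {x} {c} x≤c/n =
  ≤-trans (*-monoʳ-≤ n x≤c/n) (subst (_≤ c) (*-comm (c / n) n) (m/n*n≤m c n))

𝟙 : ∀ {p} {P : Set p} → Dec P → ℕ
𝟙 (yes _) = 1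
𝟙 (no _)  = 0

𝟙-mono : ∀ {p q} {P : Set p} {Q : Set q} (P? : Dec P) (Q? : Dec Q) →
  (P → Q) → 𝟙 P? ≤ 𝟙 Q?
𝟙-mono (yes _) (yes _) _   = ≤-refl
𝟙-mono (yes p) (no ¬q) P⇒Q = contradiction (P⇒Q p) ¬q
𝟙-mono (no _)  _       _   = z≤n

𝟙-cong : ∀ {p q} {P : Set p} {Q : Set q} (P? : Dec P) (Q? : Dec Q) →
  (P → Q) → (Q → P) → 𝟙 P? ≡ 𝟙 Q?
𝟙-cong P? Q? P⇒Q Q⇒P = ≤-antisym (𝟙-mono P? Q? P⇒Q) (𝟙-mono Q? P? Q⇒P)

1≤𝟙 : ∀ {p} {P : Set p} (P? : Dec P) → P → 1 ≤ 𝟙 P?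
1≤𝟙 (yes _) _ = ≤-refl
1≤𝟙 (no ¬p) p = contradiction p ¬p

module _ {a p} {A : Set a} {P : Pred A p} (P? : Decidable P) where

  length-filter-applyUpTo : ∀ (f : ℕ → A) N →
    length (filter P? (applyUpTo f N)) ≡ ∑[ k < N ] 𝟙 (P? (f k))
  length-filter-applyUpTo f zero = refl
  length-filter-applyUpTo f (suc N) with P? (f 0)
  ... | yes _ = cong suc (length-filter-applyUpTo (f ∘ suc) N)
  ... | no  _ = length-filter-applyUpTo (f ∘ suc) N

  length-filter-tabulate : ∀ {N} (f : Fin N → A) →
    length (filter P? (tabulate f)) ≡ sum (λ i → 𝟙 (P? (f i)))
  length-filter-tabulate {zero}  f = refl
  length-filter-tabulate {suc N} f with P? (f Fin.zero)
  ... | yes _ = cong suc (length-filter-tabulate (f ∘ Fin.suc))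
  ... | no  _ = length-filter-tabulate (f ∘ Fin.suc)

sum-toℕ : ∀ N (F : ℕ → ℕ) → sum {N} (F ∘ toℕ) ≡ ∑ N F
sum-toℕ zero    F = refl
sum-toℕ (suc N) F = cong (_+_ (F 0)) (sum-toℕ N (F ∘ suc))

length-filter-n*≤ : ∀ n .{{_ : NonZero n}} (f : Fin n → ℕ) c →
  length (filter (λ b → n * f b ≤? c) (allFin n)) ≡ sum (λ b → 𝟙 (f b <? suc (c / n)))
length-filter-n*≤ n f c = trans (length-filter-tabulate (λ b → n * f b ≤? c) (λ b → b))
  (sum-cong-≗ {n} λ b → 𝟙-cong (n * f b ≤? c) (f b <? suc (c / n))
                                (s≤s ∘ n*x≤c⇒x≤c/n n) (x≤c/n⇒n*x≤c n ∘ ≤-pred))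

<1+n-elim : ∀ {ℓ} (A : ℕ → Set ℓ) {t N} → t < suc N → (t < N → A t) → A N → A t
<1+n-elim A t<1+N below at with m<1+n⇒m<n∨m≡n t<1+N
... | inj₁ t<N  = below t<N
... | inj₂ refl = at

module _ (v : ℕ → ℤ) where

  all-or-maximal-counterexample : ∀ {q} {Q : Pred ℕ q} (Q? : Decidable Q) N →
    (∀ s → s < N → Q s) ⊎
    ∃[ s ] (s < N × ¬ Q s × (∀ t → t < N → ¬ Q t → v t ℤ.≤ v s))
  all-or-maximal-counterexample Q? zero = inj₁ (λ _ ())
  all-or-maximal-counterexample {Q = Q} Q? (suc N)
    with all-or-maximal-counterexample Q? N | Q? N
  ... | inj₁ all | yes qN = inj₁ λ s s<1+N → <1+n-elim Q s<1+N (all s) qN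
  ... | inj₁ all | no ¬qN = inj₂ (N , n<1+n N , ¬qN , λ t t<1+N →
          <1+n-elim (λ t → ¬ Q t → v t ℤ.≤ v N) t<1+N (contradiction ∘ all t) (λ _ → ℤP.≤-refl))
  ... | inj₂ (s , s<N , ¬qs , max) | yes qN = inj₂ (s , m<n⇒m<1+n s<N , ¬qs , λ t t<1+N →
          <1+n-elim (λ t → ¬ Q t → v t ℤ.≤ v s) t<1+N (max t) (contradiction qN))
  ... | inj₂ (s , s<N , ¬qs , max) | no ¬qN with ℤP.≤-total (v s) (v N)
  ...   | inj₁ vs≤vN = inj₂ (N , n<1+n N , ¬qN , λ t t<1+N →
          <1+n-elim (λ t → ¬ Q t → v t ℤ.≤ v N) t<1+N
                    (λ t<N ¬qt → ℤP.≤-trans (max t t<N ¬qt) vs≤vN) (λ _ → ℤP.≤-refl))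
  ...   | inj₂ vN≤vs = inj₂ (s , m<n⇒m<1+n s<N , ¬qs , λ t t<1+N →
          <1+n-elim (λ t → ¬ Q t → v t ℤ.≤ v s) t<1+N (max t) (λ _ → vN≤vs))

  rank : ℕ → ℕ → ℕ
  rank N s = ∑[ t < N ] 𝟙 (v s ℤ.<? v t)

  -- If some index has rank ≥ d, take one of maximal value: everything above it has rank < d.
  d≤∑rank<d : ∀ N d → d ≤ N → d ≤ ∑[ s < N ] 𝟙 (rank N s <? d)
  d≤∑rank<d N d d≤N with all-or-maximal-counterexample (λ s → rank N s <? d) N
  ... | inj₁ all = begin
    d              ≤⟨ d≤N ⟩
    N              ≡⟨ *-identityʳ N ⟨
    N * 1          ≡⟨ ∑-const N 1 ⟨
    ∑[ _ < N ] 1   ≤⟨ ∑-mono-≤ N (λ s s<N → 1≤𝟙 (rank N s <? d) (all s s<N)) ⟩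
    ∑[ s < N ] 𝟙 (rank N s <? d) ∎
    where open ≤-Reasoning
  ... | inj₂ (s , _ , rank≮d , max) = begin
    d              ≤⟨ ≮⇒≥ rank≮d ⟩
    rank N s       ≤⟨ ∑-mono-≤ N (λ t t<N →
                        𝟙-mono (v s ℤ.<? v t) (rank N t <? d) (above⇒rank<d t t<N)) ⟩
    ∑[ t < N ] 𝟙 (rank N t <? d) ∎
    where
    open ≤-Reasoning
    above⇒rank<d : ∀ t → t < N → v s ℤ.< v t → rank N t < d
    above⇒rank<d t t<N vs<vt with rank N t <? d
    ... | yes rank<d = rank<d
    ... | no  rank≮d = contradiction (max t t<N rank≮d) (ℤP.<⇒≱ vs<vt)

a≡b+q*c⇒b≡a+-q*c : ∀ {a b} q c → a ≡ b ℤ.+ q ℤ.* c → b ≡ a ℤ.+ ℤ.- q ℤ.* c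
a≡b+q*c⇒b≡a+-q*c {b = b} q c refl = cancel b q c
  where
  cancel : ∀ b q c → b ≡ b ℤ.+ q ℤ.* c ℤ.+ ℤ.- q ℤ.* c
  cancel = solve-∀

CommutesWithShift : ℕ → (ℤ → ℤ) → Set
CommutesWithShift n f = ∀ x → f (x ℤ.+ + n) ≡ f x ℤ.+ + n

module _ {n : ℕ} (f : ℤ → ℤ) (f-shift : CommutesWithShift n f) where

  shift⇒+-ℕ-multiple : ∀ j x → f (x ℤ.+ + (j * n)) ≡ f x ℤ.+ + (j * n)
  shift⇒+-ℕ-multiple zero    x = trans (cong f (ℤP.+-identityʳ x)) (sym (ℤP.+-identityʳ _))
  shift⇒+-ℕ-multiple (suc j) x = begin
    f (x ℤ.+ (+ n ℤ.+ + (j * n)))        ≡⟨ cong f (shuffle x (+ n) (+ (j * n))) ⟩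
    f (x ℤ.+ + (j * n) ℤ.+ + n)          ≡⟨ f-shift _ ⟩
    f (x ℤ.+ + (j * n)) ℤ.+ + n          ≡⟨ cong (ℤ._+ + n) (shift⇒+-ℕ-multiple j x) ⟩
    f x ℤ.+ + (j * n) ℤ.+ + n            ≡⟨ shuffle (f x) (+ n) (+ (j * n)) ⟨
    f x ℤ.+ (+ n ℤ.+ + (j * n))          ∎
    where
    open ≡-Reasoning
    shuffle : ∀ a b c → a ℤ.+ (b ℤ.+ c) ≡ a ℤ.+ c ℤ.+ b
    shuffle = solve-∀

  shift⇒+-multiple : ∀ x k → f (x ℤ.+ k ℤ.* + n) ≡ f x ℤ.+ k ℤ.* + n
  shift⇒+-multiple x (+ j) =
    subst (λ c → f (x ℤ.+ c) ≡ f x ℤ.+ c) (ℤP.pos-* j n) (shift⇒+-ℕ-multiple j x)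
  shift⇒+-multiple x -[1+ j ] = begin
    f y                     ≡⟨ cancel (f y) K ⟩
    f y ℤ.+ K ℤ.- K         ≡⟨ cong (ℤ._- K) (shift⇒+-multiple y (+ suc j)) ⟨
    f (y ℤ.+ K) ℤ.- K       ≡⟨ cong (λ z → f z ℤ.- K) (cancel′ x (+ suc j) (+ n)) ⟩
    f x ℤ.- K               ≡⟨ negate (f x) (+ suc j) (+ n) ⟩
    f x ℤ.+ -[1+ j ] ℤ.* + n ∎
    where
    open ≡-Reasoning
    y = x ℤ.+ -[1+ j ] ℤ.* + n
    K = + suc j ℤ.* + n
    cancel : ∀ a b → a ≡ a ℤ.+ b ℤ.- b
    cancel = solve-∀
    cancel′ : ∀ x k c → x ℤ.+ ℤ.- k ℤ.* c ℤ.+ k ℤ.* c ≡ x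
    cancel′ = solve-∀
    negate : ∀ a k c → a ℤ.- k ℤ.* c ≡ a ℤ.+ ℤ.- k ℤ.* c
    negate = solve-∀

module _ (N : ℕ) .{{_ : NonZero N}} where

  residue : ℤ → Fin N
  residue z = fromℕ< (n%ℕd<d z N)

  residue-quotient : ∀ z → z ≡ + toℕ (residue z) ℤ.+ (z /ℕ N) ℤ.* + N
  residue-quotient z = trans (a≡a%ℕn+[a/ℕn]*n z N)
    (cong (λ r → + r ℤ.+ (z /ℕ N) ℤ.* + N) (sym (toℕ-fromℕ< _)))

  residue-toℕ : ∀ r → residue (+ toℕ r) ≡ r
  residue-toℕ r = toℕ-injective (trans (toℕ-fromℕ< _) (m<n⇒m%n≡m (toℕ<n r)))

  ≢+positive-multiple : ∀ {x} y j → x < N → + x ≢ + y ℤ.+ + suc j ℤ.* + N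
  ≢+positive-multiple {x} y j x<N eq = <⇒≱ x<N (begin
    N             ≤⟨ m≤m+n N (j * N) ⟩
    suc j * N     ≤⟨ m≤n+m (suc j * N) y ⟩
    y + suc j * N ≡⟨ ℤP.+-injective (trans (cong (ℤ._+_ (+ y)) (ℤP.pos-* (suc j) N)) (sym eq)) ⟩
    x             ∎)
    where open ≤-Reasoning

  residue-unique : ∀ {x y} k → x < N → y < N → + x ≡ + y ℤ.+ k ℤ.* + N → x ≡ y
  residue-unique {y = y} (+ zero)   _   _   eq = ℤP.+-injective (trans eq (ℤP.+-identityʳ (+ y)))
  residue-unique {y = y} (+ suc j)  x<N _   eq = contradiction eq (≢+positive-multiple y j x<N)
  residue-unique {x = x} -[1+ j ]   _   y<N eq =
    contradiction (a≡b+q*c⇒b≡a+-q*c -[1+ j ] (+ N) eq) (≢+positive-multiple x j y<N)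

  residue-+-multiple : ∀ z k → residue (z ℤ.+ k ℤ.* + N) ≡ residue z
  residue-+-multiple z k =
    toℕ-injective (residue-unique (q ℤ.+ k ℤ.- q′) (toℕ<n _) (toℕ<n _) (begin
      ρ′
        ≡⟨ a≡b+q*c⇒b≡a+-q*c q′ (+ N) (residue-quotient z′) ⟩
      z ℤ.+ k ℤ.* + N ℤ.+ ℤ.- q′ ℤ.* + N
        ≡⟨ cong (λ x → x ℤ.+ k ℤ.* + N ℤ.+ ℤ.- q′ ℤ.* + N) (residue-quotient z) ⟩
      ρ ℤ.+ q ℤ.* + N ℤ.+ k ℤ.* + N ℤ.+ ℤ.- q′ ℤ.* + N
        ≡⟨ collect ρ q k q′ (+ N) ⟩
      ρ ℤ.+ (q ℤ.+ k ℤ.- q′) ℤ.* + N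
        ∎))
    where
    open ≡-Reasoning
    ρ  = + toℕ (residue z)
    z′ = z ℤ.+ k ℤ.* + N
    ρ′ = + toℕ (residue z′)
    q  = z /ℕ N
    q′ = z′ /ℕ N
    collect : ∀ r q k q′ c →
      r ℤ.+ q ℤ.* c ℤ.+ k ℤ.* c ℤ.+ ℤ.- q′ ℤ.* c ≡ r ℤ.+ (q ℤ.+ k ℤ.- q′) ℤ.* c
    collect = solve-∀

  residue-cancel : ∀ (f g : ℤ → ℤ) → CommutesWithShift N f → (∀ x → g (f x) ≡ x) →
    ∀ r → residue (g (+ toℕ (residue (f (+ toℕ r))))) ≡ r
  residue-cancel f g f-shift g∘f r = begin
    residue (g ρ)                         ≡⟨ cong (residue ∘ g) ρ≡f[x-qN] ⟩
    residue (g (f (x ℤ.+ ℤ.- q ℤ.* + N))) ≡⟨ cong residue (g∘f _) ⟩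
    residue (x ℤ.+ ℤ.- q ℤ.* + N)         ≡⟨ residue-+-multiple x (ℤ.- q) ⟩
    residue x                             ≡⟨ residue-toℕ r ⟩
    r                                     ∎
    where
    open ≡-Reasoning
    x = + toℕ r
    ρ = + toℕ (residue (f x))
    q = f x /ℕ N
    ρ≡f[x-qN] : ρ ≡ f (x ℤ.+ ℤ.- q ℤ.* + N)
    ρ≡f[x-qN] = trans (a≡b+q*c⇒b≡a+-q*c q (+ N) (residue-quotient (f x)))
                      (sym (shift⇒+-multiple f f-shift x (ℤ.- q)))

  inverse-commutesWithShift : ∀ (f g : ℤ → ℤ) →
    (∀ y → f (g y) ≡ y) → (∀ x → g (f x) ≡ x) → CommutesWithShift N f → CommutesWithShift N g
  inverse-commutesWithShift f g f∘g g∘f f-shift y = begin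
    g (y ℤ.+ + N)       ≡⟨ cong (λ z → g (z ℤ.+ + N)) (f∘g y) ⟨
    g (f (g y) ℤ.+ + N) ≡⟨ cong g (f-shift (g y)) ⟨
    g (f (g y ℤ.+ + N)) ≡⟨ g∘f _ ⟩
    g y ℤ.+ + N         ∎
    where open ≡-Reasoning

  residuePermutation : ∀ (f g : ℤ → ℤ) →
    (∀ y → f (g y) ≡ y) → (∀ x → g (f x) ≡ x) → CommutesWithShift N f → Permutation N N
  residuePermutation f g f∘g g∘f f-shift = permutation
    (λ r → residue (g (+ toℕ r)))
    (λ r → residue (f (+ toℕ r)))
    (residue-cancel f g f-shift g∘f)
    (residue-cancel g f (inverse-commutesWithShift f g f∘g g∘f f-shift) f∘g)

module _ {n : ℕ} (w : AffinePerm n) where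

  ω∘inv : ∀ y → ω w (inv w y) ≡ y
  ω∘inv y = proj₂ (proj₂ (bij w) y) refl

  inv∘ω : ∀ x → inv w (ω w x) ≡ x
  inv∘ω x = proj₁ (bij w) (ω∘inv (ω w x))

  ω-+-multiple : ∀ x k → ω w (x ℤ.+ k ℤ.* + n) ≡ ω w x ℤ.+ k ℤ.* + n
  ω-+-multiple = shift⇒+-multiple (ω w) (periodic w)

  inversionsAt : ℕ → ℤ → ℕ
  inversionsAt m y = ∑[ k < m ∸ 1 ] 𝟙 (ω w y ℤ.<? ω w (y ℤ.- + suc k))

  PS≡inversionsAt-inv : ∀ m α → PS m w α ≡ inversionsAt m (inv w α)
  PS≡inversionsAt-inv m α = begin
    length (filter (λ k → α ℤ.<? ω w (y ℤ.- + k)) (map suc (upTo (m ∸ 1))))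
      ≡⟨ cong (λ β → length (filter (λ k → β ℤ.<? ω w (y ℤ.- + k)) (map suc (upTo (m ∸ 1)))))
              (sym (ω∘inv α)) ⟩
    length (filter (λ k → ω w y ℤ.<? ω w (y ℤ.- + k)) (map suc (upTo (m ∸ 1))))
      ≡⟨ cong (length ∘ filter _) (map-upTo suc (m ∸ 1)) ⟩
    length (filter (λ k → ω w y ℤ.<? ω w (y ℤ.- + k)) (applyUpTo suc (m ∸ 1)))
      ≡⟨ length-filter-applyUpTo _ suc (m ∸ 1) ⟩
    inversionsAt m y
      ∎
    where
    open ≡-Reasoning
    y = inv w α

  inversionsAt-+-multiple : ∀ m y k → inversionsAt m (y ℤ.+ k ℤ.* + n) ≡ inversionsAt m y
  inversionsAt-+-multiple m y k = ∑-cong (m ∸ 1) λ j _ →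
    𝟙-cong _ _ (λ lt → unshift-< (subst₂ ℤ._<_ (ω-+-multiple y k) (shift j) lt))
               (λ lt → subst₂ ℤ._<_ (sym (ω-+-multiple y k)) (sym (shift j)) (ℤP.+-monoˡ-< c lt))
    where
    c = k ℤ.* + n
    shift : ∀ j → ω w (y ℤ.+ c ℤ.- + suc j) ≡ ω w (y ℤ.- + suc j) ℤ.+ c
    shift j = trans (cong (ω w) (swap y c (+ suc j))) (ω-+-multiple (y ℤ.- + suc j) k)
      where
      swap : ∀ y c i → y ℤ.+ c ℤ.- i ≡ y ℤ.- i ℤ.+ c
      swap = solve-∀
    unshift-< : ∀ {a b} → a ℤ.+ c ℤ.< b ℤ.+ c → a ℤ.< b
    unshift-< {a} {b} a+c<b+c =
      subst₂ ℤ._<_ (cancel a c) (cancel b c) (ℤP.+-monoˡ-< (ℤ.- c) a+c<b+c)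
      where
      cancel : ∀ x c → x ℤ.+ c ℤ.- c ≡ x
      cancel = solve-∀

  inversionsAt-ℕ-periodic : ∀ m k r → inversionsAt m (+ (k * n + r)) ≡ inversionsAt m (+ r)
  inversionsAt-ℕ-periodic m k r = begin
    inversionsAt m (+ (k * n) ℤ.+ + r)   ≡⟨ cong (inversionsAt m) (ℤP.+-comm (+ (k * n)) (+ r)) ⟩
    inversionsAt m (+ r ℤ.+ + (k * n))   ≡⟨ cong (inversionsAt m ∘ ℤ._+_ (+ r)) (ℤP.pos-* k n) ⟩
    inversionsAt m (+ r ℤ.+ + k ℤ.* + n) ≡⟨ inversionsAt-+-multiple m (+ r) (+ k) ⟩
    inversionsAt m (+ r)                 ∎
    where open ≡-Reasoning

  -- A partner y - k left of the block is moved into it by + m, which stability shows only raises ω.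
  inversionsAt≤rank : ∀ {m} s a → Stable m w → s < m →
    inversionsAt m (a ℤ.+ + s) ≤ rank (λ t → ω w (a ℤ.+ + t)) m s
  inversionsAt≤rank s a stab s<m with m≤n⇒∃[o]m+o≡n s<m
  ... | e , refl = begin
    ∑ (s + e) F                      ≡⟨ ∑-+ s e F ⟩
    ∑ s F + ∑[ k < e ] F (s + k)     ≤⟨ +-mono-≤ (∑-mono-reflect s left) (∑-mono-reflect e right) ⟩
    ∑ s T + ∑[ k < e ] T (s + suc k) ≤⟨ +-monoʳ-≤ (∑ s T) (m≤n+m _ (T (s + 0))) ⟩
    ∑ s T + ∑[ k < suc e ] T (s + k) ≡⟨ ∑-+ s (suc e) T ⟨
    ∑ (s + suc e) T                  ≡⟨ cong (λ M → ∑ M T) (+-suc s e) ⟩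
    ∑ (suc s + e) T                  ∎
    where
    open ≤-Reasoning
    y = a ℤ.+ + s
    F : ℕ → ℕ
    F k = 𝟙 (ω w y ℤ.<? ω w (y ℤ.- + suc k))
    T : ℕ → ℕ
    T t = 𝟙 (ω w y ℤ.<? ω w (a ℤ.+ + t))
    left : ∀ i j → suc (i + j) ≡ s → F i ≤ T j
    left i j eq = ≤-reflexive (cong (λ z → 𝟙 (ω w y ℤ.<? ω w z))
      (trans (cong (λ s → a ℤ.+ + s ℤ.- + suc i) (sym eq)) (back a (+ i) (+ j))))
      where
      -- + suc (i + j) is definitionally + 1 ℤ.+ + i ℤ.+ + j, so ring identities in ℤ apply.
      back : ∀ a i j → a ℤ.+ (+ 1 ℤ.+ i ℤ.+ j) ℤ.- (+ 1 ℤ.+ i) ≡ a ℤ.+ j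
      back = solve-∀
    right : ∀ i j → suc (i + j) ≡ e → F (s + i) ≤ T (s + suc j)
    right i j eq = 𝟙-mono _ _ λ lt → subst (λ z → ω w y ℤ.< ω w z) p+m≡ (ℤP.<-trans lt (stab p))
      where
      p = y ℤ.- + suc (s + i)
      wrap : ∀ a s i j → a ℤ.+ s ℤ.- (+ 1 ℤ.+ (s ℤ.+ i)) ℤ.+ (+ 1 ℤ.+ (s ℤ.+ (+ 1 ℤ.+ i ℤ.+ j)))
                         ≡ a ℤ.+ (s ℤ.+ (+ 1 ℤ.+ j))
      wrap = solve-∀
      p+m≡ : p ℤ.+ + suc (s + e) ≡ a ℤ.+ + (s + suc j)
      p+m≡ = trans (cong (λ e → p ℤ.+ + suc (s + e)) (sym eq)) (wrap a (+ s) (+ i) (+ j))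

  d≤∑inversionsAt<d : ∀ {m} d a → Stable m w → d ≤ m →
    d ≤ ∑[ s < m ] 𝟙 (inversionsAt m (a ℤ.+ + s) <? d)
  d≤∑inversionsAt<d {m} d a stab d≤m = ≤-trans (d≤∑rank<d V m d d≤m)
    (∑-mono-≤ m λ s s<m → 𝟙-mono _ _ (≤-<-trans (inversionsAt≤rank s a stab s<m)))
    where
    V : ℕ → ℤ
    V t = ω w (a ℤ.+ + t)

  n*d≤m*∑inversionsAt<d : ∀ {m} d → Stable m w → d ≤ m →
    n * d ≤ m * ∑[ r < n ] 𝟙 (inversionsAt m (+ r) <? d)
  n*d≤m*∑inversionsAt<d {m} d stab d≤m = begin
    n * d                               ≡⟨ ∑-const n d ⟨
    ∑[ _ < n ] d                        ≤⟨ ∑-mono-≤ n (λ j _ → d≤∑inversionsAt<d d (+ (j * m)) stab d≤m) ⟩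
    ∑[ j < n ] ∑[ s < m ] I (j * m + s) ≡⟨ ∑-* n m I ⟨
    ∑ (n * m) I                         ≡⟨ cong (λ M → ∑ M I) (*-comm n m) ⟩
    ∑ (m * n) I                         ≡⟨ ∑-* m n I ⟩
    ∑[ k < m ] ∑[ r < n ] I (k * n + r) ≡⟨ ∑-cong m (λ k _ → ∑-cong n λ r _ → I-periodic k r) ⟩
    ∑[ _ < m ] ∑ n I                    ≡⟨ ∑-const m (∑ n I) ⟩
    m * ∑ n I                           ∎
    where
    open ≤-Reasoning
    I : ℕ → ℕ
    I r = 𝟙 (inversionsAt m (+ r) <? d)
    I-periodic : ∀ k r → I (k * n + r) ≡ I r
    I-periodic k r = cong (λ z → 𝟙 (z <? d)) (inversionsAt-ℕ-periodic m k r)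

  sum-PS<d : .{{_ : NonZero n}} → ∀ m d →
    sum (λ (b : Fin n) → 𝟙 (PS m w (+ suc (toℕ b)) <? d)) ≡
    ∑[ r < n ] 𝟙 (inversionsAt m (+ r) <? d)
  sum-PS<d m d = begin
    sum {n} (λ b → 𝟙 (PS m w (+ suc (toℕ b)) <? d)) ≡⟨ sum-cong-≗ {n} (cong (λ z → 𝟙 (z <? d)) ∘ PS≡I∘π) ⟩
    sum {n} (I ∘ toℕ ∘ (π ⟨$⟩ʳ_))                   ≡⟨ sum-permute {n} {n} (I ∘ toℕ) π ⟨
    sum {n} (I ∘ toℕ)                               ≡⟨ sum-toℕ n I ⟩
    ∑ n I                                           ∎
    where
    open ≡-Reasoning
    I : ℕ → ℕ
    I r = 𝟙 (inversionsAt m (+ r) <? d)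
    f g : ℤ → ℤ
    f x = ω w x ℤ.- + 1
    -- + 1 ℤ.+ y rather than y ℤ.+ + 1, so that g (+ toℕ b) reduces to inv w (+ suc (toℕ b)).
    g y = inv w (+ 1 ℤ.+ y)
    f∘g : ∀ y → f (g y) ≡ y
    f∘g y = trans (cong (ℤ._- + 1) (ω∘inv (+ 1 ℤ.+ y))) (cancel y)
      where
      cancel : ∀ y → + 1 ℤ.+ y ℤ.- + 1 ≡ y
      cancel = solve-∀
    g∘f : ∀ x → g (f x) ≡ x
    g∘f x = trans (cong (inv w) (cancel (ω w x))) (inv∘ω x)
      where
      cancel : ∀ y → + 1 ℤ.+ (y ℤ.- + 1) ≡ y
      cancel = solve-∀
    f-shift : CommutesWithShift n f
    f-shift x = trans (cong (ℤ._- + 1) (periodic w x)) (swap (ω w x) (+ n))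
      where
      swap : ∀ y c → y ℤ.+ c ℤ.- + 1 ≡ y ℤ.- + 1 ℤ.+ c
      swap = solve-∀
    π : Permutation n n
    π = residuePermutation n f g f∘g g∘f f-shift
    PS≡I∘π : ∀ b → PS m w (+ suc (toℕ b)) ≡ inversionsAt m (+ toℕ (π ⟨$⟩ʳ b))
    PS≡I∘π b = begin
      PS m w α                                          ≡⟨ PS≡inversionsAt-inv m α ⟩
      inversionsAt m (inv w α)                          ≡⟨ cong (inversionsAt m) (residue-quotient n (inv w α)) ⟩
      inversionsAt m (+ toℕ (residue n (inv w α)) ℤ.+ q ℤ.* + n)
                                                        ≡⟨ inversionsAt-+-multiple m _ q ⟩
      inversionsAt m (+ toℕ (residue n (inv w α)))      ∎
      where
      α = + suc (toℕ b)
      q = inv w α /ℕ n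

mainTheorem2 : (m n : ℕ) → NonZero m → NonZero n → Coprime m n →
    (w : AffinePerm n) → Stable m w →
    IsParking m n (λ (a : Fin n) → PS m w (+ suc (toℕ a)))
mainTheorem2 m n m≢0 n≢0 _ w stab i = ≰⇒> count≰t
  where
  instance
    m-nonZero : NonZero m
    m-nonZero = m≢0
    n-nonZero : NonZero n
    n-nonZero = n≢0
  t = toℕ i
  d = suc (t * m / n)
  f : Fin n → ℕ
  f b = PS m w (+ suc (toℕ b))
  count = length (filter (λ b → n * f b ≤? t * m) (allFin n))
  d≤m : d ≤ m
  d≤m = m<n*o⇒m/o<n (subst (t * m <_) (*-comm n m) (*-monoˡ-< m (toℕ<n i)))
  count≰t : ¬ count ≤ t
  count≰t count≤t = <-irrefl refl (n*x≤c⇒x≤c/n n (begin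
    n * d                                           ≤⟨ n*d≤m*∑inversionsAt<d w d stab d≤m ⟩
    m * ∑[ r < n ] 𝟙 (inversionsAt w m (+ r) <? d) ≡⟨ cong (m *_) (sum-PS<d w m d) ⟨
    m * sum {n} (λ b → 𝟙 (f b <? d))               ≡⟨ cong (m *_) (length-filter-n*≤ n f (t * m)) ⟨
    m * count                                       ≤⟨ *-monoʳ-≤ m count≤t ⟩
    m * t                                           ≡⟨ *-comm m t ⟩
    t * m                                           ∎))
    where open ≤-Reasoning
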